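{- Let $n\ge 1$ and $1\le m<2^{n/2}$ be integers. Let $R=\mathcal{X}\times\mathcal{Y}$ with $\mathcal{X},\mathcal{Y}\subseteq\{0,1\}^{nm}$ be a rectangle with $|R|\ge 2^{2nm-m+2}$. View each element of $\{0,1\}^{nm}$ as a list of $m$ strings from $\{0,1\}^n$. Let $s\in\{0,1\}^n$. Then there is a subrectangle $R'=\mathcal{X}'\times\mathcal{Y}'\subseteq R$, with $\mathcal{X}'\subseteq\mathcal{X}$ and $\mathcal{Y}'\subseteq\mathcal{Y}$, such that $|R'|\ge 2^{ -2n-2}|R|$ and $s$ is not a solution to $\textsc{XOR-Missing-String}$ on any $(X,Y)\in R'$.
   Context: For $X=(x_1,\dots,x_m)$ and $Y=(y_1,\dots,y_m)$ with all strings in $\{0,1\}^n$, a string $s\in\{0,1\}^n$ is a solution to $\textsc{XOR-Missing-String}$ on $(X,Y)$ if $s\ne x_i\oplus y_j$ for all $i,j\in[m]$, where $\oplus$ is bitwise XOR. -}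

module Defs where

open import Data.Bool using (Bool; _xor_)
open import Data.Nat using (ℕ)
open import Data.Fin using (Fin)
open import Data.Vec using (Vec; zipWith; lookup)
open import Data.List using (List)
open import Data.List.Membership.Propositional using (_∈_)
open import Relation.Binary.PropositionalEquality using (_≡_)
open import Relation.Nullary using (¬_)

BitString : ℕ → Set
BitString n = Vec Bool n

_⊕_ : ∀ {n} → BitString n → BitString n → BitString n
_⊕_ = zipWith _xor_

Block : ℕ → ℕ → Set
Block n m = Vec (BitString n) m

IsXorMissingSolution : ∀ {n m} → Block n m → Block n m → BitString n → Set
IsXorMissingSolution {n} {m} X Y s =
  (i j : Fin m) → ¬ (s ≡ lookup X i ⊕ lookup Y j)

-- finite subset A ⊆ B, both given as duplicate-free lists
_⊆L_ : ∀ {A : Set} → List A → List A → Set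
xs ⊆L ys = ∀ {x} → x ∈ xs → x ∈ ys

module Submission where

-- Call a string a heavy for a list of blocks Z when at least a 2^-(n+1) fraction of Z has a as an
-- entry. If some a is heavy for 𝒳 while a ⊕ s is heavy for 𝒴, the blocks containing a, resp. a ⊕ s,
-- form the subrectangle: on it x_i ⊕ y_j = a ⊕ (a ⊕ s) = s for suitable i, j. Otherwise the heavy
-- strings of 𝒳 and the strings a with a ⊕ s heavy for 𝒴 are disjoint, say k + l ≤ 2^n of them.
-- Blocks having a light entry make up at most half of 𝒳 (at most 2^n light strings, each in fewer
-- than |𝒳| / 2^(n+1) blocks), so |𝒳| ≤ 2 k^m; likewise |𝒴| ≤ 2 l^m, and AM-GM bounds |𝒳| |𝒴| by
-- 2^(2nm - 2m + 2), too small for the rectangle.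

open import Defs
open import Data.Nat using (ℕ; _+_; _*_; _∸_; _^_; _≤_; _<_)
open import Data.List using (List; length)
open import Data.List.Relation.Unary.Unique.Propositional using (Unique)
open import Data.List.Membership.Propositional using (_∈_)
open import Data.Product using (Σ; _×_; _,_)
open import Relation.Nullary using (¬_)

open import Data.Bool using (true; false; _xor_)
import Data.Bool as Bool
open import Data.Bool.Properties using (xor-assoc; xor-same; xor-identityʳ)
open import Data.Fin using (Fin; zero; suc)
open import Data.Fin.Properties using (injective⇒≤; all?; ¬∀⟶∃¬) renaming (any? to anyFin?)
import Data.List as List
open import Data.List using ([]; _∷_; [_]; _++_; map; filter; concatMap; cartesianProductWith)
open import Data.List.Properties using (length-++; length-map; length-filter)
open import Data.List.Membership.Propositional using (_∉_; lose)
open import Data.List.Membership.Propositional.Properties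
  using (∈-lookup; ∈-++⁺ˡ; ∈-++⁺ʳ; ∈-map⁺; ∈-filter⁺; ∈-filter⁻; ∈-concatMap⁺; ∈-cartesianProductWith⁺)
import Data.List.Membership.DecPropositional as DecMembership
open import Data.List.Relation.Unary.All as All using ()
open import Data.List.Relation.Unary.Any as Any using (here; there; any?; satisfied)
open import Data.List.Relation.Unary.Any.Properties using (lookup-index)
open import Data.List.Relation.Unary.AllPairs using (_∷_)
open import Data.List.Relation.Unary.Unique.Propositional.Properties using (filter⁺)
open import Data.Nat using (zero; suc; z≤n; s≤s)
open import Data.Nat.Properties
open import Data.Nat.Solver using (module +-*-Solver)
open import Data.Product using (∃; proj₁; proj₂)
open import Data.Sum using ([_,_]′)
open import Data.Vec using (Vec; []; _∷_; lookup)
import Data.Vec.Properties as Vec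
open import Function.Base using (case_of_)
open import Function.Definitions using (Injective)
open import Level using (0ℓ)
open import Relation.Binary.Definitions using (DecidableEquality)
open import Relation.Binary.PropositionalEquality 
  using (_≡_; refl; sym; trans; cong; cong₂; subst; subst₂; module ≡-Reasoning)
open import Relation.Nullary using (yes; no; contradiction)
open import Relation.Nullary.Decidable using (_×-dec_)
open import Relation.Unary using (Pred; Decidable)
open import Relation.Unary.Properties using (∁?)

open +-*-Solver

module _ {A : Set} where

  Unique⇒lookup-injective : ∀ {xs : List A} → Unique xs →
    ∀ i j → List.lookup xs i ≡ List.lookup xs j → i ≡ j
  Unique⇒lookup-injective (_ ∷ _) zero zero _ = refl
  Unique⇒lookup-injective (x≢ ∷ _) zero (suc j) eq = contradiction eq (All.lookup x≢ (∈-lookup j))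
  Unique⇒lookup-injective (x≢ ∷ _) (suc i) zero eq = contradiction (sym eq) (All.lookup x≢ (∈-lookup i))
  Unique⇒lookup-injective (_ ∷ xs!) (suc i) (suc j) eq = cong suc (Unique⇒lookup-injective xs! i j eq)

  Unique-⊆⇒length-≤ : ∀ {xs ys : List A} → Unique xs → xs ⊆L ys → length xs ≤ length ys
  Unique-⊆⇒length-≤ {xs} {ys} xs! xs⊆ys = injective⇒≤ {f = position} position-injective
    where
    position : Fin (length xs) → Fin (length ys)
    position i = Any.index (xs⊆ys (∈-lookup i))

    position-injective : Injective _≡_ _≡_ position
    position-injective {i} {j} eq = Unique⇒lookup-injective xs! i j (begin
      List.lookup xs i             ≡⟨ lookup-index (xs⊆ys (∈-lookup i)) ⟩
      List.lookup ys (position i)  ≡⟨ cong (List.lookup ys) eq ⟩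
      List.lookup ys (position j)  ≡⟨ lookup-index (xs⊆ys (∈-lookup j)) ⟨
      List.lookup xs j             ∎)
      where open ≡-Reasoning

module _ {A B C : Set} where

  length-cartesianProductWith : (f : A → B → C) (xs : List A) (ys : List B) →
    length (cartesianProductWith f xs ys) ≡ length xs * length ys
  length-cartesianProductWith f [] ys = refl
  length-cartesianProductWith f (x ∷ xs) ys = begin
    length (map (f x) ys ++ cartesianProductWith f xs ys)
      ≡⟨ length-++ (map (f x) ys) ⟩
    length (map (f x) ys) + length (cartesianProductWith f xs ys)
      ≡⟨ cong₂ _+_ (length-map (f x) ys) (length-cartesianProductWith f xs ys) ⟩
    length ys + length xs * length ys ∎
    where open ≡-Reasoning

module _ {A : Set} where

  vecsOver : List A → (m : ℕ) → List (Vec A m)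
  vecsOver as zero = [ [] ]
  vecsOver as (suc m) = cartesianProductWith _∷_ as (vecsOver as m)

  length-vecsOver : ∀ as m → length (vecsOver as m) ≡ length as ^ m
  length-vecsOver as zero = refl
  length-vecsOver as (suc m) =
    trans (length-cartesianProductWith _∷_ as (vecsOver as m)) (cong (length as *_) (length-vecsOver as m))

  ∈-vecsOver⁺ : ∀ {as m} (v : Vec A m) → (∀ i → lookup v i ∈ as) → v ∈ vecsOver as m
  ∈-vecsOver⁺ [] _ = here refl
  ∈-vecsOver⁺ (x ∷ v) v⊆as = ∈-cartesianProductWith⁺ _∷_ (v⊆as zero) (∈-vecsOver⁺ v (λ i → v⊆as (suc i)))

  length-filter-disjoint : ∀ {P Q : Pred A 0ℓ} (P? : Decidable P) (Q? : Decidable Q) →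
    (∀ x → P x → ¬ Q x) → ∀ xs → length (filter P? xs) + length (filter Q? xs) ≤ length xs
  length-filter-disjoint P? Q? P⇒¬Q [] = z≤n
  length-filter-disjoint P? Q? P⇒¬Q (x ∷ xs)
    with ih ← length-filter-disjoint P? Q? P⇒¬Q xs | P? x | Q? x
  ... | yes p | yes q = contradiction q (P⇒¬Q x p)
  ... | yes _ | no _  = s≤s ih
  ... | no _  | yes _ = ≤-trans (≤-reflexive (+-suc _ _)) (s≤s ih)
  ... | no _  | no _  = m≤n⇒m≤1+n ih

module _ {B C : Set} (F : B → List C) where

  *-length-concatMap≤ : ∀ c L bs → (∀ {b} → b ∈ bs → c * length (F b) ≤ L) →
    c * length (concatMap F bs) ≤ length bs * L
  *-length-concatMap≤ c L [] _ = ≤-reflexive (*-zeroʳ c)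
  *-length-concatMap≤ c L (b ∷ bs) bound = begin
    c * length (F b ++ concatMap F bs)             ≡⟨ cong (c *_) (length-++ (F b)) ⟩
    c * (length (F b) + length (concatMap F bs))   ≡⟨ *-distribˡ-+ c (length (F b)) _ ⟩
    c * length (F b) + c * length (concatMap F bs) ≤⟨ +-mono-≤ (bound (here refl)) rest ⟩
    L + length bs * L                              ∎
    where
    open ≤-Reasoning
    rest = *-length-concatMap≤ c L bs (λ b∈ → bound (there b∈))

  2*length-concatMap≤ : ∀ {N L} bs → length bs ≤ N → (∀ {b} → b ∈ bs → 2 * N * length (F b) < L) →
    2 * length (concatMap F bs) ≤ L
  2*length-concatMap≤ [] _ _ = z≤n
  2*length-concatMap≤ {zero} (_ ∷ _) () _
  2*length-concatMap≤ {suc N} {L} bs@(_ ∷ _) bs≤N short = *-cancelˡ-≤ (suc N) (begin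
    suc N * (2 * S)  ≡⟨ solve 2 (λ N S → N :* (con 2 :* S) := con 2 :* N :* S) refl (suc N) S ⟩
    2 * suc N * S    ≤⟨ *-length-concatMap≤ (2 * suc N) L bs (λ b∈ → <⇒≤ (short b∈)) ⟩
    length bs * L    ≤⟨ *-monoˡ-≤ L bs≤N ⟩
    suc N * L        ∎)
    where
    open ≤-Reasoning
    S = length (concatMap F bs)

m≤n+o⇒2*o≤m⇒m≤2*n : ∀ {m n o} → m ≤ n + o → 2 * o ≤ m → m ≤ 2 * n
m≤n+o⇒2*o≤m⇒m≤2*n {m} {n} {o} m≤n+o 2o≤m = +-cancelʳ-≤ m m (2 * n) (begin
  m + m               ≤⟨ +-mono-≤ m≤n+o m≤n+o ⟩
  (n + o) + (n + o)   ≡⟨ solve 2 (λ n o → (n :+ o) :+ (n :+ o) := con 2 :* n :+ con 2 :* o) refl n o ⟩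
  2 * n + 2 * o       ≤⟨ +-monoʳ-≤ (2 * n) 2o≤m ⟩
  2 * n + m           ∎)
  where open ≤-Reasoning

^-distribʳ-* : ∀ a b m → (a * b) ^ m ≡ a ^ m * b ^ m
^-distribʳ-* a b zero = refl
^-distribʳ-* a b (suc m) = trans (cong (a * b *_) (^-distribʳ-* a b m))
  (solve 4 (λ a b x y → (a :* b) :* (x :* y) := (a :* x) :* (b :* y)) refl a b (a ^ m) (b ^ m))

4*m*n≤[m+n]² : ∀ k l → 4 * (k * l) ≤ (k + l) * (k + l)
4*m*n≤[m+n]² k l = [ ordered , flipped ]′ (≤-total k l)
  where
  -- (k + (k + d))² = 4k(k + d) + d²
  ordered : ∀ {k l} → k ≤ l → 4 * (k * l) ≤ (k + l) * (k + l)
  ordered {k} {l} k≤l = subst (λ l → 4 * (k * l) ≤ (k + l) * (k + l)) (m+[n∸m]≡n k≤l)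
    (subst (4 * (k * (k + d)) ≤_)
      (solve 2 (λ k d → con 4 :* (k :* (k :+ d)) :+ d :* d := (k :+ (k :+ d)) :* (k :+ (k :+ d))) refl k d)
      (m≤m+n _ (d * d)))
    where d = l ∸ k

  flipped : l ≤ k → 4 * (k * l) ≤ (k + l) * (k + l)
  flipped l≤k = subst₂ (λ x y → 4 * x ≤ y * y) (*-comm l k) (+-comm l k) (ordered l≤k)

4^m*[a*b]≤4*[N*N]^m : ∀ m {a b k l N} → a ≤ 2 * k ^ m → b ≤ 2 * l ^ m → k + l ≤ N →
  4 ^ m * (a * b) ≤ 4 * (N * N) ^ m
4^m*[a*b]≤4*[N*N]^m m {a} {b} {k} {l} {N} a≤ b≤ k+l≤N = begin
  4 ^ m * (a * b)                    ≤⟨ *-monoʳ-≤ (4 ^ m) (*-mono-≤ a≤ b≤) ⟩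
  4 ^ m * (2 * k ^ m * (2 * l ^ m))  ≡⟨ solve 3 (λ x y z → x :* (con 2 :* y :* (con 2 :* z)) := con 4 :* (x :* (y :* z)))
                                          refl (4 ^ m) (k ^ m) (l ^ m) ⟩
  4 * (4 ^ m * (k ^ m * l ^ m))      ≡⟨ cong (λ x → 4 * (4 ^ m * x)) (^-distribʳ-* k l m) ⟨
  4 * (4 ^ m * (k * l) ^ m)          ≡⟨ cong (4 *_) (^-distribʳ-* 4 (k * l) m) ⟨
  4 * (4 * (k * l)) ^ m              ≤⟨ *-monoʳ-≤ 4 (^-monoˡ-≤ m 4kl≤N*N) ⟩
  4 * (N * N) ^ m                    ∎
  where
  open ≤-Reasoning
  4kl≤N*N : 4 * (k * l) ≤ N * N
  4kl≤N*N = ≤-trans (4*m*n≤[m+n]² k l) (*-mono-≤ k+l≤N k+l≤N)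

4*[2^n*2^n]^m<4^m*2^[2nm∸m+2] : ∀ n m → 1 ≤ m → 4 * (2 ^ n * 2 ^ n) ^ m < 4 ^ m * 2 ^ (2 * n * m ∸ m + 2)
4*[2^n*2^n]^m<4^m*2^[2nm∸m+2] n m 1≤m = begin-strict
  4 * (2 ^ n * 2 ^ n) ^ m     ≡⟨ cong (λ x → 4 * x ^ m) (^-distribˡ-+-* 2 n n) ⟨
  4 * (2 ^ (n + n)) ^ m       ≡⟨ cong (4 *_) (^-*-assoc 2 (n + n) m) ⟩
  4 * 2 ^ ((n + n) * m)       ≡⟨ cong (λ e → 4 * 2 ^ e) (solve 2 (λ n m → (n :+ n) :* m := con 2 :* n :* m) refl n m) ⟩
  2 ^ 2 * 2 ^ p               ≡⟨ ^-distribˡ-+-* 2 2 p ⟨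
  2 ^ (2 + p)                 <⟨ ^-monoʳ-< 2 (s≤s (s≤s z≤n)) exponent< ⟩
  2 ^ (2 * m + (p ∸ m + 2))   ≡⟨ ^-distribˡ-+-* 2 (2 * m) (p ∸ m + 2) ⟩
  2 ^ (2 * m) * 2 ^ (p ∸ m + 2) ≡⟨ cong (_* 2 ^ (p ∸ m + 2)) (^-*-assoc 2 2 m) ⟨
  4 ^ m * 2 ^ (p ∸ m + 2)     ∎
  where
  open ≤-Reasoning
  p = 2 * n * m
  exponent< : 2 + p < 2 * m + (p ∸ m + 2)
  exponent< = begin-strict
    2 + p                     ≤⟨ +-monoʳ-≤ 2 (m≤n+m∸n p m) ⟩
    2 + (m + (p ∸ m))         <⟨ m<n+m _ 1≤m ⟩
    m + (2 + (m + (p ∸ m)))   ≡⟨ solve 2 (λ m q → m :+ (con 2 :+ (m :+ q)) := con 2 :* m :+ (q :+ con 2)) refl m (p ∸ m) ⟩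
    2 * m + (p ∸ m + 2)       ∎

-- AM-GM: a b ≤ 4 (k l)^m ≤ 4 (2^(2n) / 4)^m = 2^(2nm - 2m + 2).
few-symbols⇒small-rectangle : ∀ n m {a b k l} → 1 ≤ m → a ≤ 2 * k ^ m → b ≤ 2 * l ^ m → k + l ≤ 2 ^ n →
  a * b < 2 ^ (2 * n * m ∸ m + 2)
few-symbols⇒small-rectangle n m {a} {b} 1≤m a≤ b≤ k+l≤ = *-cancelˡ-< (4 ^ m) (a * b) _
  (≤-<-trans (4^m*[a*b]≤4*[N*N]^m m a≤ b≤ k+l≤) (4*[2^n*2^n]^m<4^m*2^[2nm∸m+2] n m 1≤m))

module Blocks {A : Set} (_≟_ : DecidableEquality A) (univ : List A) (∈-univ : ∀ a → a ∈ univ) (m : ℕ) where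

  open DecMembership _≟_ using (_∈?_)

  Occurs : A → Vec A m → Set
  Occurs a X = ∃ λ i → lookup X i ≡ a

  occurs? : ∀ a → Decidable (Occurs a)
  occurs? a X = anyFin? (λ i → lookup X i ≟ a)

  containing : A → List (Vec A m) → List (Vec A m)
  containing a = filter (occurs? a)

  containing-⊆ : ∀ a Z → containing a Z ⊆L Z
  containing-⊆ a Z X∈ = proj₁ (∈-filter⁻ (occurs? a) {xs = Z} X∈)

  ∈-containing⇒Occurs : ∀ {a} Z {X} → X ∈ containing a Z → Occurs a X
  ∈-containing⇒Occurs {a} Z X∈ = proj₂ (∈-filter⁻ (occurs? a) {xs = Z} X∈)

  Heavy : List (Vec A m) → A → Set
  Heavy Z a = length Z ≤ 2 * length univ * length (containing a Z)

  heavy? : ∀ Z → Decidable (Heavy Z)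
  heavy? Z a = length Z ≤? 2 * length univ * length (containing a Z)

  ⊆-vecsOver-++-containing : ∀ H Z →
    Z ⊆L (vecsOver H m ++ concatMap (λ b → containing b Z) (filter (∁? (_∈? H)) univ))
  ⊆-vecsOver-++-containing H Z {X} X∈Z with all? (λ i → lookup X i ∈? H)
  ... | yes X⊆H = ∈-++⁺ˡ (∈-vecsOver⁺ X X⊆H)
  ... | no X⊈H with i , Xᵢ∉H ← ¬∀⟶∃¬ m _ (λ i → lookup X i ∈? H) X⊈H =
    ∈-++⁺ʳ (vecsOver H m) (∈-concatMap⁺ (λ b → containing b Z)
      (lose (∈-filter⁺ (∁? (_∈? H)) (∈-univ (lookup X i)) Xᵢ∉H) (∈-filter⁺ (occurs? _) X∈Z (i , refl))))

  few-heavy⇒few-blocks : ∀ Z → Unique Z → (H : List A) → (∀ b → b ∉ H → ¬ Heavy Z b) →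
    length Z ≤ 2 * length H ^ m
  few-heavy⇒few-blocks Z Z! H light = m≤n+o⇒2*o≤m⇒m≤2*n {n = length H ^ m} covered half
    where
    lightBlocks : List (Vec A m)
    lightBlocks = concatMap (λ b → containing b Z) (filter (∁? (_∈? H)) univ)

    covered : length Z ≤ length H ^ m + length lightBlocks
    covered = begin
      length Z                                    ≤⟨ Unique-⊆⇒length-≤ Z! (⊆-vecsOver-++-containing H Z) ⟩
      length (vecsOver H m ++ lightBlocks)        ≡⟨ length-++ (vecsOver H m) ⟩
      length (vecsOver H m) + length lightBlocks  ≡⟨ cong (_+ length lightBlocks) (length-vecsOver H m) ⟩
      length H ^ m + length lightBlocks           ∎
      where open ≤-Reasoning

    half : 2 * length lightBlocks ≤ length Z
    half = 2*length-concatMap≤ (λ b → containing b Z) (filter (∁? (_∈? H)) univ) (length-filter (∁? (_∈? H)) univ)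
      (λ b∈ → ≰⇒> (light _ (proj₂ (∈-filter⁻ (∁? (_∈? H)) {xs = univ} b∈))))

⊕-cancelˡ : ∀ {n} (a s : BitString n) → a ⊕ (a ⊕ s) ≡ s
⊕-cancelˡ [] [] = refl
⊕-cancelˡ (x ∷ a) (y ∷ s) = cong₂ _∷_ (trans (sym (xor-assoc x x y)) (cong (_xor y) (xor-same x))) (⊕-cancelˡ a s)

⊕-cancelʳ : ∀ {n} (b s : BitString n) → (b ⊕ s) ⊕ s ≡ b
⊕-cancelʳ [] [] = refl
⊕-cancelʳ (x ∷ b) (y ∷ s) =
  cong₂ _∷_ (trans (xor-assoc x y y) (trans (cong (x xor_) (xor-same y)) (xor-identityʳ x))) (⊕-cancelʳ b s)

bitStrings : (n : ℕ) → List (BitString n)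
bitStrings = vecsOver (true ∷ false ∷ [])

∈-bitStrings : ∀ {n} (a : BitString n) → a ∈ bitStrings n
∈-bitStrings a = ∈-vecsOver⁺ a (λ i → bit∈ (lookup a i))
  where
  bit∈ : ∀ b → b ∈ true ∷ false ∷ []
  bit∈ true = here refl
  bit∈ false = there (here refl)

length-bitStrings : ∀ n → length (bitStrings n) ≡ 2 ^ n
length-bitStrings = length-vecsOver (true ∷ false ∷ [])

module XorBlocks (n m : ℕ) (s : BitString n) where

  open Blocks (Vec.≡-dec Bool._≟_) (bitStrings n) ∈-bitStrings m public

  occurs-⊕⇒¬solution : ∀ a X Y → Occurs a X → Occurs (a ⊕ s) Y → ¬ IsXorMissingSolution X Y s
  occurs-⊕⇒¬solution a X Y (i , Xᵢ≡a) (j , Yⱼ≡a⊕s) solution = solution i j (begin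
    s                    ≡⟨ ⊕-cancelˡ a s ⟨
    a ⊕ (a ⊕ s)          ≡⟨ cong₂ _⊕_ Xᵢ≡a Yⱼ≡a⊕s ⟨
    lookup X i ⊕ lookup Y j ∎)
    where open ≡-Reasoning

  heavy×heavy⇒large : ∀ 𝒳 𝒴 a b → Heavy 𝒳 a → Heavy 𝒴 b →
    length 𝒳 * length 𝒴 ≤ 2 ^ (2 * n + 2) * (length (containing a 𝒳) * length (containing b 𝒴))
  heavy×heavy⇒large 𝒳 𝒴 a b 𝒳-heavy 𝒴-heavy = begin
    length 𝒳 * length 𝒴                ≤⟨ *-mono-≤ 𝒳-heavy 𝒴-heavy ⟩
    (c * x) * (c * y)                   ≡⟨ solve 3 (λ c x y → (c :* x) :* (c :* y) := (c :* c) :* (x :* y)) refl c x y ⟩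
    (c * c) * (x * y)                   ≡⟨ cong (λ c → c * c * (x * y)) (cong (2 *_) (length-bitStrings n)) ⟩
    (2 ^ suc n * 2 ^ suc n) * (x * y)   ≡⟨ cong (_* (x * y)) (^-distribˡ-+-* 2 (suc n) (suc n)) ⟨
    2 ^ (suc n + suc n) * (x * y)       ≡⟨ cong (λ e → 2 ^ e * (x * y)) exponent ⟩
    2 ^ (2 * n + 2) * (x * y)           ∎
    where
    open ≤-Reasoning
    exponent : suc n + suc n ≡ 2 * n + 2
    exponent = solve 1 (λ n → con 1 :+ n :+ (con 1 :+ n) := con 2 :* n :+ con 2) refl n
    c x y : ℕ
    c = 2 * length (bitStrings n)
    x = length (containing a 𝒳)
    y = length (containing b 𝒴)

  no-heavy-pair⇒small : ∀ {𝒳 𝒴} → Unique 𝒳 → Unique 𝒴 → 1 ≤ m →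
    (∀ a → Heavy 𝒳 a → ¬ Heavy 𝒴 (a ⊕ s)) →
    length 𝒳 * length 𝒴 < 2 ^ (2 * n * m ∸ m + 2)
  no-heavy-pair⇒small {𝒳} {𝒴} 𝒳! 𝒴! 1≤m disjoint = few-symbols⇒small-rectangle n m 1≤m
    (few-heavy⇒few-blocks 𝒳 𝒳! heavy𝒳 light𝒳)
    (few-heavy⇒few-blocks 𝒴 𝒴! heavy𝒴 light𝒴)
    (begin
      length heavy𝒳 + length heavy𝒴
        ≡⟨ cong (length heavy𝒳 +_) (length-map (_⊕ s) (filter (heavy?⊕ 𝒴) (bitStrings n))) ⟩
      length heavy𝒳 + length (filter (heavy?⊕ 𝒴) (bitStrings n))
        ≤⟨ length-filter-disjoint (heavy? 𝒳) (heavy?⊕ 𝒴) disjoint (bitStrings n) ⟩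
      length (bitStrings n)          ≡⟨ length-bitStrings n ⟩
      2 ^ n                          ∎)
    where
    open ≤-Reasoning
    heavy?⊕ : ∀ Z → Decidable (λ a → Heavy Z (a ⊕ s))
    heavy?⊕ Z a = heavy? Z (a ⊕ s)

    heavy𝒳 heavy𝒴 : List (BitString n)
    heavy𝒳 = filter (heavy? 𝒳) (bitStrings n)
    heavy𝒴 = map (_⊕ s) (filter (heavy?⊕ 𝒴) (bitStrings n))

    light𝒳 : ∀ b → b ∉ heavy𝒳 → ¬ Heavy 𝒳 b
    light𝒳 b b∉ b-heavy = b∉ (∈-filter⁺ (heavy? 𝒳) (∈-bitStrings b) b-heavy)

    light𝒴 : ∀ b → b ∉ heavy𝒴 → ¬ Heavy 𝒴 b
    light𝒴 b b∉ b-heavy = b∉ (subst (_∈ heavy𝒴) (⊕-cancelʳ b s) (∈-map⁺ (_⊕ s)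
      (∈-filter⁺ (heavy?⊕ 𝒴) (∈-bitStrings (b ⊕ s)) (subst (Heavy 𝒴) (sym (⊕-cancelʳ b s)) b-heavy))))

lemma3p2 : (n m : ℕ) → 1 ≤ n → 1 ≤ m → m * m < 2 ^ n →
    (𝒳 𝒴 : List (Block n m)) → Unique 𝒳 → Unique 𝒴 →
    2 ^ (2 * n * m ∸ m + 2) ≤ length 𝒳 * length 𝒴 →
    (s : BitString n) →
    Σ (List (Block n m)) λ 𝒳′ → Σ (List (Block n m)) λ 𝒴′ →
    Unique 𝒳′ × Unique 𝒴′ × 𝒳′ ⊆L 𝒳 × 𝒴′ ⊆L 𝒴 ×
    length 𝒳 * length 𝒴 ≤ 2 ^ (2 * n + 2) * (length 𝒳′ * length 𝒴′) ×
    (∀ X Y → X ∈ 𝒳′ → Y ∈ 𝒴′ → ¬ IsXorMissingSolution X Y s)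
lemma3p2 n m _ 1≤m _ 𝒳 𝒴 𝒳! 𝒴! large s =
  case any? (λ a → heavy? 𝒳 a ×-dec heavy? 𝒴 (a ⊕ s)) (bitStrings n) of λ where
    (no no-pair) → contradiction large (<⇒≱ (no-heavy-pair⇒small 𝒳! 𝒴! 1≤m
      (λ a 𝒳-heavy 𝒴-heavy → no-pair (lose (∈-bitStrings a) (𝒳-heavy , 𝒴-heavy)))))
    (yes pair) → let a , 𝒳-heavy , 𝒴-heavy = satisfied pair in
      containing a 𝒳 , containing (a ⊕ s) 𝒴 ,
      filter⁺ (occurs? a) 𝒳! , filter⁺ (occurs? (a ⊕ s)) 𝒴! ,
      (λ {_} → containing-⊆ a 𝒳) , (λ {_} → containing-⊆ (a ⊕ s) 𝒴) ,
      heavy×heavy⇒large 𝒳 𝒴 a (a ⊕ s) 𝒳-heavy 𝒴-heavy ,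
      λ X Y X∈ Y∈ → occurs-⊕⇒¬solution a X Y (∈-containing⇒Occurs 𝒳 X∈) (∈-containing⇒Occurs 𝒴 Y∈)
  where open XorBlocks n m s
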